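{- Let $G$ be a strongly connected digraph with $\operatorname{diam}(G)\geq 3$. Then the second distance ideal of $G$ over $\mathbb{Z}[X_G]$ is trivial, i.e. $I_2(G)=\langle 1\rangle$.
   Context: A digraph is simple: no loops and no multiple arcs (both $(u,v)$ and $(v,u)$ may be arcs). It is strongly connected (strong) if for all vertices $u,v$ there is a directed $uv$-walk. $\operatorname{dist}(u,v)$ is the number of arcs in a shortest directed $uv$-walk, and $\operatorname{diam}(G)=\max_{u,v}\operatorname{dist}(u,v)$. For a strong digraph $G$ with vertex set $V$, let $X_G=\{x_u: u\in V\}$ be indeterminates, $D(G)$ the distance matrix ($uv$-entry $\operatorname{dist}(u,v)$), and $D_X(G)=\operatorname{diag}(x_u)_{u\in V}+D(G)$. For $i\in[|V|]$, the $i$-th distance ideal $I_i(G)$ is the ideal of $\mathbb{Z}[X_G]$ generated by all $i\times i$ minors of $D_X(G)$. An ideal is trivial if it equals $\langle 1\rangle$. -}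

module Defs where

open import Data.Nat using (ℕ; zero; suc; _≤_; _<_; _⊔_)
open import Data.Integer as ℤ using (ℤ; +_)
open import Data.Fin using (Fin; toℕ)
open import Data.Fin.Properties using (_≟_)
open import Data.Bool using (Bool; true; false)
open import Data.List using (List; []; _∷_; foldr; concatMap; map; allFin)
open import Data.Product using (Σ; _×_; _,_; ∃)
open import Relation.Binary.PropositionalEquality using (_≡_)
open import Relation.Nullary using (yes; no)

-- Simple digraphs on the vertex set Fin n.
-- Arcs are given by a Boolean adjacency relation, so multiple arcs are
-- impossible; looplessness is a field.  Both (u,v) and (v,u) may be arcs.

record Digraph (n : ℕ) : Set where
  field
    arc      : Fin n → Fin n → Bool
    loopless : ∀ u → arc u u ≡ false

open Digraph public

data Walk {n : ℕ} (G : Digraph n) : Fin n → Fin n → ℕ → Set where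
  stay : ∀ u → Walk G u u zero
  step : ∀ {u w v k} → arc G u w ≡ true → Walk G w v k → Walk G u v (suc k)

Strong : ∀ {n} → Digraph n → Set
Strong {n} G = ∀ (u v : Fin n) → ∃ λ k → Walk G u v k

IsDistance : ∀ {n} → Digraph n → (Fin n → Fin n → ℕ) → Set
IsDistance {n} G d =
  ∀ (u v : Fin n) → Walk G u v (d u v) × (∀ m → Walk G u v m → d u v ≤ m)

diam : ∀ {n} → (Fin n → Fin n → ℕ) → ℕ
diam {n} d = foldr _⊔_ 0 (concatMap (λ u → map (d u) (allFin n)) (allFin n))

-- The polynomial ring ℤ[x_0, …, x_{n-1}], constructed as the free
-- commutative ring over ℤ on n generators: syntactic terms modulo the
-- congruence generated by the commutative-ring axioms and the requirement
-- that integer constants form a ring homomorphism ℤ → ℤ[X].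

infixl 6 _⊕_
infixl 7 _⊗_
infix 4 _≈_

data Poly (n : ℕ) : Set where
  var : Fin n → Poly n
  con : ℤ → Poly n
  _⊕_ : Poly n → Poly n → Poly n
  _⊗_ : Poly n → Poly n → Poly n
  ⊖_  : Poly n → Poly n

data _≈_ {n : ℕ} : Poly n → Poly n → Set where
  ≈-refl  : ∀ {p} → p ≈ p
  ≈-sym   : ∀ {p q} → p ≈ q → q ≈ p
  ≈-trans : ∀ {p q r} → p ≈ q → q ≈ r → p ≈ r
  ⊕-cong : ∀ {p p′ q q′} → p ≈ p′ → q ≈ q′ → p ⊕ q ≈ p′ ⊕ q′
  ⊗-cong : ∀ {p p′ q q′} → p ≈ p′ → q ≈ q′ → p ⊗ q ≈ p′ ⊗ q′
  ⊖-cong : ∀ {p q} → p ≈ q → ⊖ p ≈ ⊖ q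
  ⊕-assoc : ∀ p q r → (p ⊕ q) ⊕ r ≈ p ⊕ (q ⊕ r)
  ⊕-comm  : ∀ p q → p ⊕ q ≈ q ⊕ p
  ⊕-idʳ   : ∀ p → p ⊕ con (+ 0) ≈ p
  ⊖-invʳ  : ∀ p → p ⊕ ⊖ p ≈ con (+ 0)
  ⊗-assoc : ∀ p q r → (p ⊗ q) ⊗ r ≈ p ⊗ (q ⊗ r)
  ⊗-comm  : ∀ p q → p ⊗ q ≈ q ⊗ p
  ⊗-idʳ   : ∀ p → p ⊗ con (+ 1) ≈ p
  distribʳ : ∀ p q r → (p ⊕ q) ⊗ r ≈ (p ⊗ r) ⊕ (q ⊗ r)
  con-+ : ∀ a b → con a ⊕ con b ≈ con (a ℤ.+ b)
  con-* : ∀ a b → con a ⊗ con b ≈ con (a ℤ.* b)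
  con-- : ∀ a → ⊖ con a ≈ con (ℤ.- a)

combine : ∀ {n} {I : Set} → (I → Poly n) → List (Poly n × I) → Poly n
combine gens []            = con (+ 0)
combine gens ((c , i) ∷ l) = c ⊗ gens i ⊕ combine gens l

InIdeal : ∀ {n} {I : Set} → (I → Poly n) → Poly n → Set
InIdeal {n} gens p = Σ (List (Poly n × _)) λ l → combine gens l ≈ p

TrivialIdeal : ∀ {n} {I : Set} → (I → Poly n) → Set
TrivialIdeal gens = InIdeal gens (con (+ 1))

DX : ∀ {n} → (Fin n → Fin n → ℕ) → Fin n → Fin n → Poly n
DX d u v with u ≟ v
... | yes _ = var u ⊕ con (+ d u v)
... | no  _ = con (+ 0) ⊕ con (+ d u v)

Index2 : ℕ → Set
Index2 n = Σ (Fin n × Fin n) λ r → Σ (Fin n × Fin n) λ c →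
  (toℕ (Data.Product.proj₁ r) < toℕ (Data.Product.proj₂ r)) ×
  (toℕ (Data.Product.proj₁ c) < toℕ (Data.Product.proj₂ c))

minor2 : ∀ {n} → (Fin n → Fin n → Poly n) → Index2 n → Poly n
minor2 M ((r₁ , r₂) , (c₁ , c₂) , _) =
  M r₁ c₁ ⊗ M r₂ c₂ ⊕ ⊖ (M r₁ c₂ ⊗ M r₂ c₁)

I₂-trivial : ∀ {n} → (Fin n → Fin n → ℕ) → Set
I₂-trivial d = TrivialIdeal (minor2 (DX d))

{-# OPTIONS --safe #-}
module Submission where

-- Take u, v with dist(u, v) = diam ≥ 3 and a shortest walk u = a → b → c → e → ⋯ → v.
-- Subwalks of a shortest walk are shortest, so rows a, b and columns c, e of D(G)
-- form the submatrix [[2, 3], [1, 2]].  None of these entries is diagonal, so the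
-- corresponding 2×2 minor of D_X(G) is the constant 2·2 − 3·1 = 1, and I₂(G) = ⟨1⟩.

open import Defs
open import Data.Nat using (ℕ; _≤_; suc; _+_; s≤s)
open import Data.Nat.Properties
  using (⊔-sel; ≤-refl; ≤-trans; ≤-reflexive; ≤-antisym; +-monoʳ-≤; +-monoˡ-≤; +-cancelʳ-≤; +-cancelˡ-≤; n≤0⇒n≡0; m<n⇒n≢0; 0≢1+n)
open import Data.Fin using (Fin; _<_)
open import Data.Fin.Properties using (<-cmp) renaming (_≟_ to _≟ᶠ_)
open import Data.Integer as ℤ using (+_)
open import Data.List using (_∷_; []; concatMap; map; allFin)
open import Data.List.Relation.Unary.Any using (satisfied)
open import Data.List.Membership.Propositional.Properties using (foldr-selective; ∈-concatMap⁻; ∈-map⁻)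
open import Data.Product using (_×_; _,_; ∃₂; proj₁; proj₂)
open import Data.Sum using (_⊎_; inj₁; inj₂)
open import Function using (case_of_)
open import Relation.Nullary using (contradiction; yes; no)
open import Relation.Binary.Definitions using (tri<; tri≈; tri>)
open import Relation.Binary.PropositionalEquality using (_≡_; _≢_; refl; sym; trans; cong)

+-≤-tight : ∀ {a b i j} → a ≤ i → b ≤ j → i + j ≤ a + b → a ≡ i × b ≡ j
+-≤-tight {a} {b} {i} {j} a≤i b≤j i+j≤a+b =
  ≤-antisym a≤i (+-cancelʳ-≤ j i a (≤-trans i+j≤a+b (+-monoʳ-≤ a b≤j))) ,
  ≤-antisym b≤j (+-cancelˡ-≤ i j b (≤-trans i+j≤a+b (+-monoˡ-≤ b a≤i)))

≢⇒<⊎> : ∀ {n} {x y : Fin n} → x ≢ y → x < y ⊎ y < x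
≢⇒<⊎> {x = x} {y} x≢y with <-cmp x y
... | tri< x<y _ _ = inj₁ x<y
... | tri≈ _ x≡y _ = contradiction x≡y x≢y
... | tri> _ _ y<x = inj₂ y<x

diam-attained : ∀ {n} (d : Fin n → Fin n → ℕ) → diam d ≢ 0 → ∃₂ λ u v → diam d ≡ d u v
diam-attained {n} d diam≢0 with foldr-selective ⊔-sel 0 (concatMap (λ u → map (d u) (allFin n)) (allFin n))
... | inj₁ diam≡0 = contradiction diam≡0 diam≢0
... | inj₂ diam∈ with satisfied (∈-concatMap⁻ (λ u → map (d u) (allFin n)) {xs = allFin n} diam∈)
...   | u , diam∈row with ∈-map⁻ (d u) diam∈row
...     | v , _ , diam≡duv = u , v , diam≡duv

≡⇒≈ : ∀ {n} {p q : Poly n} → p ≡ q → p ≈ q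
≡⇒≈ refl = ≈-refl

unit-generator⇒trivial : ∀ {n} {I : Set} {gens : I → Poly n} i {m} →
                         gens i ≈ con m → m ℤ.* m ≡ + 1 → TrivialIdeal gens
unit-generator⇒trivial i {m} gᵢ≈m m²≡1 =
  ((con m , i) ∷ []) ,
  ≈-trans (⊕-idʳ _) (≈-trans (⊗-cong ≈-refl gᵢ≈m) (≈-trans (con-* m m) (≡⇒≈ (cong con m²≡1))))

module _ {n} {d : Fin n → Fin n → ℕ} (d-diag : ∀ x → d x x ≡ 0) where

  DX-pos : ∀ {x y k} → d x y ≡ suc k → DX d x y ≈ con (+ suc k)
  DX-pos {x} {y} dxy≡1+k with x ≟ᶠ y
  ... | yes refl = contradiction (trans (sym (d-diag x)) dxy≡1+k) 0≢1+n
  ... | no  _    = ≈-trans (⊕-comm _ _) (≈-trans (⊕-idʳ _) (≡⇒≈ (cong (λ m → con (+ m)) dxy≡1+k)))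

  minor2-DX : ∀ {r₁ r₂ c₁ c₂ p q s t} (r₁<r₂ : r₁ < r₂) (c₁<c₂ : c₁ < c₂) →
              d r₁ c₁ ≡ suc p → d r₂ c₂ ≡ suc q → d r₁ c₂ ≡ suc s → d r₂ c₁ ≡ suc t →
              minor2 (DX d) ((r₁ , r₂) , (c₁ , c₂) , r₁<r₂ , c₁<c₂) ≈
              con (+ suc p ℤ.* + suc q ℤ.- + suc s ℤ.* + suc t)
  minor2-DX _ _ d₁₁ d₂₂ d₁₂ d₂₁ =
    ≈-trans (⊕-cong (DX-product d₁₁ d₂₂) (≈-trans (⊖-cong (DX-product d₁₂ d₂₁)) (con-- _))) (con-+ _ _)
    where
      DX-product : ∀ {x y x′ y′ k k′} → d x y ≡ suc k → d x′ y′ ≡ suc k′ →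
                   DX d x y ⊗ DX d x′ y′ ≈ con (+ suc k ℤ.* + suc k′)
      DX-product dxy dx′y′ = ≈-trans (⊗-cong (DX-pos dxy) (DX-pos dx′y′)) (con-* _ _)

  unimodular-submatrix⇒I₂-trivial : ∀ {a b c e} →
    d a c ≡ 2 → d a e ≡ 3 → d b c ≡ 1 → d b e ≡ 2 → I₂-trivial d
  unimodular-submatrix⇒I₂-trivial {a} {b} {c} {e} dac dae dbc dbe with ≢⇒<⊎> a≢b | ≢⇒<⊎> c≢e
    where
      a≢b : a ≢ b
      a≢b refl = case trans (sym dae) dbe of λ ()
      c≢e : c ≢ e
      c≢e refl = case trans (sym dac) dae of λ ()
  -- Index2 only lists minors with increasing rows and columns; reordering
  -- a, b or c, e may flip the sign of the determinant, and −1 is still a unit.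
  ... | inj₁ a<b | inj₁ c<e =
    unit-generator⇒trivial (_ , _ , a<b , c<e) (minor2-DX a<b c<e dac dbe dae dbc) refl
  ... | inj₁ a<b | inj₂ e<c =
    unit-generator⇒trivial (_ , _ , a<b , e<c) (minor2-DX a<b e<c dae dbc dac dbe) refl
  ... | inj₂ b<a | inj₁ c<e =
    unit-generator⇒trivial (_ , _ , b<a , c<e) (minor2-DX b<a c<e dbc dae dbe dac) refl
  ... | inj₂ b<a | inj₂ e<c =
    unit-generator⇒trivial (_ , _ , b<a , e<c) (minor2-DX b<a e<c dbe dac dbc dae) refl

_++ʷ_ : ∀ {n} {G : Digraph n} {u w v i j} → Walk G u w i → Walk G w v j → Walk G u v (i + j)
stay _   ++ʷ q = q
step e p ++ʷ q = step e (p ++ʷ q)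

module Geodesics {n} {G : Digraph n} {d : Fin n → Fin n → ℕ} (isDist : IsDistance G d) where

  d-min : ∀ {u v m} → Walk G u v m → d u v ≤ m
  d-min {u} {v} = proj₂ (isDist u v) _

  d-diag : ∀ x → d x x ≡ 0
  d-diag x = n≤0⇒n≡0 (d-min (stay x))

  d-triangle : ∀ u w v → d u v ≤ d u w + d w v
  d-triangle u w v = d-min (proj₁ (isDist u w) ++ʷ proj₁ (isDist w v))

  geodesic-split : ∀ {u w v i j} → Walk G u w i → Walk G w v j → i + j ≤ d u v →
                   d u w ≡ i × d w v ≡ j
  geodesic-split {u} {w} {v} p q i+j≤duv =
    +-≤-tight (d-min p) (d-min q) (≤-trans i+j≤duv (d-triangle u w v))

  long-geodesic⇒I₂-trivial : ∀ {u v L} → Walk G u v L → L ≤ d u v → 3 ≤ L → I₂-trivial d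
  long-geodesic⇒I₂-trivial (stay _) _ ()
  long-geodesic⇒I₂-trivial (step _ (stay _)) _ (s≤s ())
  long-geodesic⇒I₂-trivial (step _ (step _ (stay _))) _ (s≤s (s≤s ()))
  long-geodesic⇒I₂-trivial {a} {v} (step {w = b} ab (step {w = c} bc (step {w = e} {k = k} ce R))) geo _ =
    unimodular-submatrix⇒I₂-trivial d-diag dac dae dbc dbe
    where
      dbv : d b v ≡ 2 + k
      dbv = proj₂ (geodesic-split (step ab (stay b)) (step bc (step ce R)) geo)
      dac : d a c ≡ 2
      dac = proj₁ (geodesic-split (step ab (step bc (stay c))) (step ce R) geo)
      dae : d a e ≡ 3
      dae = proj₁ (geodesic-split (step ab (step bc (step ce (stay e)))) R geo)
      dbc : d b c ≡ 1
      dbc = proj₁ (geodesic-split (step bc (stay c)) (step ce R) (≤-reflexive (sym dbv)))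
      dbe : d b e ≡ 2
      dbe = proj₁ (geodesic-split (step bc (step ce (stay e))) R (≤-reflexive (sym dbv)))

lemma7 : (n : ℕ) (G : Digraph n) (d : Fin n → Fin n → ℕ) →
    Strong G → IsDistance G d → 3 ≤ diam d → I₂-trivial d
lemma7 _ _ d _ isDist 3≤diam with diam-attained d (m<n⇒n≢0 3≤diam)
... | u , v , diam≡duv =
  long-geodesic⇒I₂-trivial (proj₁ (isDist u v)) ≤-refl (≤-trans 3≤diam (≤-reflexive diam≡duv))
  where open Geodesics isDist
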